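{- For $n\ge 2$ and $2\le k\le 2n-2$, $$f_{2n}(2n,k)=\mathrm{Ent}_{2n-2}(k-1).$$
   Context: An increasing tree of size $N$ is a planar binary tree with $N$ nodes labeled bijectively by $1,\dots,N$, the root labeled $1$, each node having $0$, $1$ or $2$ children, each child designated as a left child or a right child (at most one of each), and each node's label smaller than its children's labels. Its rightmost node is the node reached from the root by repeatedly moving to the right child until a node without right child is reached. The tree is complete if every node is either a leaf or has two children, except that when $N$ is even the rightmost node has exactly one child, which is a left child. Let $\mathfrak T_N$ be the set of complete increasing trees of size $N$. For $t\in\mathfrak T_N$: for a node $a$ with children, let $\min a$ be the smallest label of its children; the minimal chain is $a_1=1, a_2=\min a_1,\dots$, continued until a leaf $a_j$ is reached, and $\mathrm{eoc}(t):=a_j$. The node labeled $N$ is a leaf; $\mathrm{pom}(t)$ is the label of its parent. $\mathrm{ent}(t)$ is the label of the rightmost node of $t$, and $\mathrm{Ent}_N(j):=\#\{t\in\mathfrak T_N:\mathrm{ent}(t)=j\}$. Set $f_{2n}(m,k):=\#\{t\in\mathfrak T_{2n}:\mathrm{eoc}(t)=m,\ \mathrm{pom}(t)=k\}$. -}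

module Defs where

open import Data.Nat using (ℕ; zero; suc; _+_; _≡ᵇ_; _<ᵇ_)
open import Data.Bool using (Bool; true; false; _∧_; _∨_; if_then_else_; T)
open import Data.List using (List; []; _∷_; _++_; length; upTo)
open import Data.Bool.ListAction using (all; any)
open import Data.Maybe using (Maybe; just; nothing; _<∣>_)
open import Data.Product using (Σ; _×_)
open import Relation.Binary.PropositionalEquality using (_≡_)

data Tree : Set where
  nil : Tree
  nd  : ℕ → Tree → Tree → Tree

size : Tree → ℕ
size nil = 0
size (nd _ l r) = suc (size l + size r)

labels : Tree → List ℕ
labels nil = []
labels (nd a l r) = a ∷ (labels l ++ labels r)

rootIs : ℕ → Tree → Bool
rootIs n nil = false
rootIs n (nd a _ _) = a ≡ᵇ n

childOK : ℕ → Tree → Bool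
childOK a nil = true
childOK a (nd b _ _) = a <ᵇ b

increasing : Tree → Bool
increasing nil = true
increasing (nd a l r) = childOK a l ∧ childOK a r ∧ increasing l ∧ increasing r

-- labels are a bijection onto {1,…,N}
labelledBy : ℕ → Tree → Bool
labelledBy N t = (length (labels t) ≡ᵇ N)
               ∧ all (λ i → any (λ x → x ≡ᵇ suc i) (labels t)) (upTo N)

isIncreasingTree : ℕ → Tree → Bool
isIncreasingTree N t = (size t ≡ᵇ N) ∧ labelledBy N t ∧ increasing t ∧ rootIs 1 t

full : Tree → Bool
full nil = true
full (nd _ nil nil) = true
full (nd _ l@(nd _ _ _) r@(nd _ _ _)) = full l ∧ full r
full (nd _ (nd _ _ _) nil) = false
full (nd _ nil (nd _ _ _)) = false

nonEmpty : Tree → Bool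
nonEmpty nil = false
nonEmpty (nd _ _ _) = true

fullExceptRightmost : Tree → Bool
fullExceptRightmost nil = false
fullExceptRightmost (nd _ l nil) = nonEmpty l ∧ full l
fullExceptRightmost (nd _ l r@(nd _ _ _)) = nonEmpty l ∧ full l ∧ fullExceptRightmost r

isEven : ℕ → Bool
isEven zero = true
isEven (suc zero) = false
isEven (suc (suc n)) = isEven n

isComplete : ℕ → Tree → Bool
isComplete N t = if isEven N then fullExceptRightmost t else full t

isCIT : ℕ → Tree → Bool
isCIT N t = isIncreasingTree N t ∧ isComplete N t

eoc : Tree → ℕ
eoc nil = 0
eoc (nd a nil nil) = a
eoc (nd a l@(nd _ _ _) nil) = eoc l
eoc (nd a nil r@(nd _ _ _)) = eoc r
eoc (nd a l@(nd b _ _) r@(nd c _ _)) = if b <ᵇ c then eoc l else eoc r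

parentOf : ℕ → Tree → Maybe ℕ
parentOf N nil = nothing
parentOf N (nd a l r) =
  if rootIs N l ∨ rootIs N r then just a else (parentOf N l <∣> parentOf N r)

pom : ℕ → Tree → Maybe ℕ
pom N t = parentOf N t

ent : Tree → ℕ
ent nil = 0
ent (nd a _ nil) = a
ent (nd a _ r@(nd _ _ _)) = ent r

-- the set { t ∈ 𝔗_{2n} : eoc t = m, pom t = k }  (f_{2n}(m,k) is its cardinality)
F : ℕ → ℕ → ℕ → Set
F n m k = Σ Tree (λ t → T (isCIT (n + n) t) × eoc t ≡ m × pom (n + n) t ≡ just k)

-- the set { t ∈ 𝔗_N : ent t = j }  (Ent_N(j) is its cardinality)
EntSet : ℕ → ℕ → Set
EntSet N j = Σ Tree (λ t → T (isCIT N t) × ent t ≡ j)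

-- If t ∈ 𝔗_{2n} has eoc t = 2n, its minimal chain runs straight down the right spine
-- 1 = s₀, s₁, …, s_r: each s_{i+1} is smaller than the root of its left sibling Lᵢ, and L_r is the
-- single leaf 2n (in a full subtree the chain could only end at 2n if the subtree were that leaf,
-- as 2n is the largest label and labels are distinct).  Hence pom t = s_r = ent t.  Removing the
-- leaf and moving the spine one step up, so that position i carries s_{i+1} − 1 and keeps Lᵢ with
-- all labels lowered by one, yields a tree of 𝔗_{2n−2} whose rightmost label is pom t − 1;
-- pushing the spine back down and re-attaching the leaf 2n inverts this.

module Submission where

open import Defs
open import Data.Nat
  using (ℕ; zero; suc; pred; _≤_; _<_; _+_; _∸_; z≤n; s≤s; _≡ᵇ_; _<ᵇ_; _≟_; _<?_; _≤?_)
open import Data.Nat.Properties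
open import Data.Nat.Solver using (module +-*-Solver)
open import Data.Bool using (Bool; true; false; _∧_; if_then_else_; T)
open import Data.Bool.Properties using (T-∧; T-irrelevant; ∧-identityʳ)
open import Data.Bool.ListAction using (all; any)
open import Data.Unit using (⊤; tt)
open import Data.Empty using (⊥; ⊥-elim)
open import Data.Product using (Σ; _×_; _,_; proj₁; proj₂)
open import Data.Sum using (_⊎_; inj₁; inj₂)
open import Data.List using (List; []; _∷_; _++_; length; applyUpTo)
open import Data.List.Properties using (length-++)
open import Data.Maybe using (just; nothing)
import Data.Maybe.Properties as Maybe
open import Relation.Nullary using (yes; no)
open import Relation.Binary.PropositionalEquality
open import Axiom.UniquenessOfIdentityProofs using (module Decidable⇒UIP)
open import Function.Bundles using (_↔_; mk↔ₛ′; Equivalence)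
open +-*-Solver using (solve; _:+_; _:=_; con)

∧-split : ∀ {a b} → T (a ∧ b) → T a × T b
∧-split = Equivalence.to T-∧

∧-intro : ∀ {a b} → T a → T b → T (a ∧ b)
∧-intro p q = Equivalence.from T-∧ (p , q)

≡ᵇ-refl : ∀ j → (j ≡ᵇ j) ≡ true
≡ᵇ-refl zero    = refl
≡ᵇ-refl (suc j) = ≡ᵇ-refl j

<ᵇ-false : ∀ {m n} → n < m → (m <ᵇ n) ≡ false
<ᵇ-false {m} {n} n<m with m <ᵇ n in e
... | false = refl
... | true  = ⊥-elim (<-asym n<m (<ᵇ⇒< m n (subst T (sym e) tt)))

<ᵇ-false⇒≥ : ∀ {m n} → (m <ᵇ n) ≡ false → n ≤ m
<ᵇ-false⇒≥ {m} {n} e with m <? n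
... | yes m<n = ⊥-elim (subst T e (<⇒<ᵇ m<n))
... | no  m≮n = ≮⇒≥ m≮n

δ : ℕ → ℕ → ℕ
δ j x = if x ≡ᵇ j then 1 else 0

δ-self : ∀ j → δ j j ≡ 1
δ-self j rewrite ≡ᵇ-refl j = refl

δ-≢ : ∀ {j x} → x ≢ j → δ j x ≡ 0
δ-≢ {j} {x} x≢j with x ≡ᵇ j in e
... | false = refl
... | true  = ⊥-elim (x≢j (≡ᵇ⇒≡ x j (subst T (sym e) tt)))

δ≡0⇒≢ᵇ : ∀ {j x} → δ j x ≡ 0 → (x ≡ᵇ j) ≡ false
δ≡0⇒≢ᵇ {j} {x} e with x ≡ᵇ j
... | false = refl

count : ℕ → List ℕ → ℕ
count j []       = 0
count j (x ∷ xs) = δ j x + count j xs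

count-++ : ∀ j xs ys → count j (xs ++ ys) ≡ count j xs + count j ys
count-++ j []       ys = refl
count-++ j (x ∷ xs) ys rewrite count-++ j xs ys = sym (+-assoc (δ j x) _ _)

mult : ℕ → Tree → ℕ
mult j nil        = 0
mult j (nd a l r) = δ j a + mult j l + mult j r

mult≡count : ∀ j t → mult j t ≡ count j (labels t)
mult≡count j nil = refl
mult≡count j (nd a l r)
  rewrite count-++ j (labels l) (labels r) | mult≡count j l | mult≡count j r = +-assoc (δ j a) _ _

length-labels : ∀ t → length (labels t) ≡ size t
length-labels nil = refl
length-labels (nd a l r)
  rewrite length-++ (labels l) {labels r} | length-labels l | length-labels r = refl

mult-root : ∀ a l r → 1 ≤ mult a (nd a l r)
mult-root a l r rewrite δ-self a = s≤s z≤n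

mult-left : ∀ x a l r → mult x l ≤ mult x (nd a l r)
mult-left x a l r = ≤-trans (m≤n+m (mult x l) (δ x a)) (m≤m+n _ (mult x r))

mult-right : ∀ x a l r → mult x r ≤ mult x (nd a l r)
mult-right x a l r = m≤n+m (mult x r) _

mult-children : ∀ x a l r → mult x l + mult x r ≤ mult x (nd a l r)
mult-children x a l r = +-monoˡ-≤ (mult x r) (m≤n+m (mult x l) (δ x a))

AllLabels : (ℕ → Set) → Tree → Set
AllLabels P nil        = ⊤
AllLabels P (nd a l r) = P a × AllLabels P l × AllLabels P r

AllLabels-map : ∀ {P Q : ℕ → Set} → (∀ {x} → P x → Q x) → ∀ t → AllLabels P t → AllLabels Q t
AllLabels-map f nil        _                = tt
AllLabels-map f (nd a l r) (pa , pl , pr) = f pa , AllLabels-map f l pl , AllLabels-map f r pr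

AllLabels⇒ : ∀ {P : ℕ → Set} x t → AllLabels P t → 1 ≤ mult x t → P x
AllLabels⇒ x (nd a l r) (pa , pl , pr) occ with x ≟ a
... | yes refl = pa
... | no  x≢a rewrite δ-≢ (≢-sym x≢a) with mult x l in e
...   | zero  = AllLabels⇒ x r pr occ
...   | suc _ = AllLabels⇒ x l pl (subst (1 ≤_) (sym e) (s≤s z≤n))

⇒AllLabels : ∀ (P : ℕ → Set) t → (∀ x → 1 ≤ mult x t → P x) → AllLabels P t
⇒AllLabels P nil        h = tt
⇒AllLabels P (nd a l r) h =
  h a (mult-root a l r) ,
  ⇒AllLabels P l (λ x occ → h x (≤-trans occ (mult-left x a l r))) ,
  ⇒AllLabels P r (λ x occ → h x (≤-trans occ (mult-right x a l r)))

mult-absent : ∀ y t → AllLabels (_< y) t → mult y t ≡ 0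
mult-absent y nil        _ = refl
mult-absent y (nd a l r) (a<y , pl , pr)
  rewrite δ-≢ (<⇒≢ a<y) | mult-absent y l pl | mult-absent y r pr = refl

-- Pigeonhole: a list of length N containing each of 1, …, N

sum₁ : (ℕ → ℕ) → ℕ → ℕ
sum₁ f zero    = 0
sum₁ f (suc N) = f (suc N) + sum₁ f N

sum₁-+ : ∀ f g N → sum₁ (λ j → f j + g j) N ≡ sum₁ f N + sum₁ g N
sum₁-+ f g zero    = refl
sum₁-+ f g (suc N) rewrite sum₁-+ f g N =
  solve 4 (λ a b c d → (a :+ b) :+ (c :+ d) := (a :+ c) :+ (b :+ d)) refl
    (f (suc N)) (g (suc N)) (sum₁ f N) (sum₁ g N)

sum₁-lower : ∀ f N → (∀ j → 1 ≤ j → j ≤ N → 1 ≤ f j) → N ≤ sum₁ f N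
sum₁-lower f zero    h = z≤n
sum₁-lower f (suc N) h =
  +-mono-≤ (h (suc N) (s≤s z≤n) ≤-refl) (sum₁-lower f N (λ j 1≤j j≤N → h j 1≤j (m≤n⇒m≤1+n j≤N)))

sum₁-lower-strict : ∀ f N → (∀ j → 1 ≤ j → j ≤ N → 1 ≤ f j) →
                    ∀ j → 1 ≤ j → j ≤ N → 2 ≤ f j → suc N ≤ sum₁ f N
sum₁-lower-strict f zero    h zero    () _  _
sum₁-lower-strict f zero    h (suc _) _  () _
sum₁-lower-strict f (suc N) h j 1≤j j≤N 2≤fj with j ≟ suc N
... | yes refl = +-mono-≤ 2≤fj (sum₁-lower f N (λ i 1≤i i≤N → h i 1≤i (m≤n⇒m≤1+n i≤N)))
... | no  j≢N  = subst (_≤ f (suc N) + sum₁ f N) (+-suc 1 N)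
      (+-mono-≤ (h (suc N) (s≤s z≤n) ≤-refl)
         (sum₁-lower-strict f N (λ i 1≤i i≤N → h i 1≤i (m≤n⇒m≤1+n i≤N))
            j 1≤j (≤-pred (≤∧≢⇒< j≤N j≢N)) 2≤fj))

inInterval : ℕ → ℕ → ℕ
inInterval N x = sum₁ (λ j → δ j x) N

inInterval-above : ∀ N x → N < x → inInterval N x ≡ 0
inInterval-above zero    x _   = refl
inInterval-above (suc N) x N<x rewrite δ-≢ (≢-sym (<⇒≢ N<x)) = inInterval-above N x (<-trans (n<1+n N) N<x)

inInterval-zero : ∀ N → inInterval N 0 ≡ 0
inInterval-zero zero    = refl
inInterval-zero (suc N) = inInterval-zero N

inInterval≤1 : ∀ N x → inInterval N x ≤ 1
inInterval≤1 zero    x = z≤n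
inInterval≤1 (suc N) x with x ≟ suc N
... | yes refl rewrite δ-self (suc N) | inInterval-above N (suc N) (n<1+n N) = ≤-refl
... | no  x≢N  rewrite δ-≢ x≢N = inInterval≤1 N x

countInInterval : ℕ → List ℕ → ℕ
countInInterval N xs = sum₁ (λ j → count j xs) N

countInInterval-∷ : ∀ N x xs → countInInterval N (x ∷ xs) ≡ inInterval N x + countInInterval N xs
countInInterval-∷ N x xs = sum₁-+ (λ j → δ j x) (λ j → count j xs) N

countInInterval≤length : ∀ N xs → countInInterval N xs ≤ length xs
countInInterval≤length N []       = ≤-reflexive (zeros N)
  where zeros : ∀ N → sum₁ (λ _ → 0) N ≡ 0
        zeros zero    = refl
        zeros (suc N) = zeros N
countInInterval≤length N (x ∷ xs) rewrite countInInterval-∷ N x xs =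
  +-mono-≤ (inInterval≤1 N x) (countInInterval≤length N xs)

countInInterval<length : ∀ N x xs → 1 ≤ count x xs → inInterval N x ≡ 0 → countInInterval N xs < length xs
countInInterval<length N x (y ∷ xs) occ miss rewrite countInInterval-∷ N y xs with y ≟ x
... | yes refl rewrite miss = s≤s (countInInterval≤length N xs)
... | no  y≢x  rewrite δ-≢ y≢x =
  s≤s (≤-trans (+-monoˡ-≤ (countInInterval N xs) (inInterval≤1 N y))
               (countInInterval<length N x xs occ miss))

pigeonhole : ∀ N xs → length xs ≡ N → (∀ i → i < N → 1 ≤ count (suc i) xs) →
             (∀ x → count x xs ≤ 1) × (∀ x → 1 ≤ count x xs → 1 ≤ x × x ≤ N)
pigeonhole N xs len cov = distinct , inside
  where
  covers : ∀ j → 1 ≤ j → j ≤ N → 1 ≤ count j xs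
  covers (suc i) _ i<N = cov i i<N

  N≤countInInterval : N ≤ countInInterval N xs
  N≤countInInterval = sum₁-lower (λ j → count j xs) N covers

  -- an entry outside {1, …, N} would leave fewer than N entries for N values
  missing-impossible : ∀ x → 1 ≤ count x xs → inInterval N x ≡ 0 → ⊥
  missing-impossible x occ miss =
    <-irrefl refl (≤-<-trans N≤countInInterval
      (≤-trans (countInInterval<length N x xs occ miss) (≤-reflexive len)))

  inside : ∀ x → 1 ≤ count x xs → 1 ≤ x × x ≤ N
  inside zero    occ = ⊥-elim (missing-impossible 0 occ (inInterval-zero N))
  inside (suc x) occ with suc x ≤? N
  ... | yes x≤N = s≤s z≤n , x≤N
  ... | no  x≰N = ⊥-elim (missing-impossible (suc x) occ (inInterval-above N (suc x) (≰⇒> x≰N)))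

  distinct : ∀ x → count x xs ≤ 1
  distinct x with count x xs ≤? 1
  ... | yes ≤1 = ≤1
  ... | no  ≰1 with inside x (≤-trans (s≤s z≤n) (≰⇒> ≰1))
  ... | 1≤x , x≤N = ⊥-elim (<-irrefl refl (<-≤-trans
          (sum₁-lower-strict (λ j → count j xs) N covers x 1≤x x≤N (≰⇒> ≰1))
          (≤-trans (countInInterval≤length N xs) (≤-reflexive len))))

Covers : ℕ → Tree → Set
Covers N t = ∀ i → i < N → 1 ≤ mult (suc i) t

any⇒count : ∀ j xs → T (any (λ x → x ≡ᵇ j) xs) → 1 ≤ count j xs
any⇒count j (x ∷ xs) p with x ≡ᵇ j
... | true  = s≤s z≤n
... | false = any⇒count j xs p

count⇒any : ∀ j xs → 1 ≤ count j xs → T (any (λ x → x ≡ᵇ j) xs)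
count⇒any j (x ∷ xs) occ with x ≡ᵇ j
... | true  = tt
... | false = count⇒any j xs occ

all-applyUpTo⇒ : ∀ (p : ℕ → Bool) f N → T (all p (applyUpTo f N)) → ∀ i → i < N → T (p (f i))
all-applyUpTo⇒ p f (suc N) h zero    _         = proj₁ (∧-split h)
all-applyUpTo⇒ p f (suc N) h (suc i) (s≤s i<N) =
  all-applyUpTo⇒ p (λ x → f (suc x)) N (proj₂ (∧-split {p (f zero)} h)) i i<N

⇒all-applyUpTo : ∀ (p : ℕ → Bool) f N → (∀ i → i < N → T (p (f i))) → T (all p (applyUpTo f N))
⇒all-applyUpTo p f zero    h = tt
⇒all-applyUpTo p f (suc N) h =
  ∧-intro (h zero (s≤s z≤n)) (⇒all-applyUpTo p (λ x → f (suc x)) N (λ i i<N → h (suc i) (s≤s i<N)))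

labelledBy⇒ : ∀ N t → T (labelledBy N t) → size t ≡ N × Covers N t
labelledBy⇒ N t h with ∧-split {length (labels t) ≡ᵇ N} h
... | len , cov =
  trans (sym (length-labels t)) (≡ᵇ⇒≡ _ _ len) ,
  λ i i<N → subst (1 ≤_) (sym (mult≡count (suc i) t))
              (any⇒count (suc i) (labels t) (all-applyUpTo⇒ _ (λ x → x) N cov i i<N))

⇒labelledBy : ∀ N t → size t ≡ N → Covers N t → T (labelledBy N t)
⇒labelledBy N t sz cov = ∧-intro {length (labels t) ≡ᵇ N}
  (≡⇒≡ᵇ _ _ (trans (length-labels t) sz))
  (⇒all-applyUpTo _ (λ x → x) N λ i i<N →
     count⇒any (suc i) (labels t) (subst (1 ≤_) (mult≡count (suc i) t) (cov i i<N)))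

labels-distinct-in-range : ∀ N t → size t ≡ N → Covers N t →
  (∀ x → mult x t ≤ 1) × AllLabels (λ x → 1 ≤ x × x ≤ N) t
labels-distinct-in-range N t sz cov with
  pigeonhole N (labels t) (trans (length-labels t) sz)
    (λ i i<N → subst (1 ≤_) (mult≡count (suc i) t) (cov i i<N))
... | distinct , inside =
  (λ x → subst (_≤ 1) (sym (mult≡count x t)) (distinct x)) ,
  ⇒AllLabels _ t (λ x occ → inside x (subst (1 ≤_) (mult≡count x t) occ))

rootOf : Tree → ℕ
rootOf nil        = 0
rootOf (nd a _ _) = a

increasing-nd : ∀ {a l r} → T (increasing (nd a l r)) →
  T (childOK a l) × T (childOK a r) × T (increasing l) × T (increasing r)
increasing-nd {a} {l} {r} h with ∧-split {childOK a l} h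
... | al , h′ with ∧-split {childOK a r} h′
... | ar , h″ with ∧-split {increasing l} h″
... | il , ir = al , ar , il , ir

labels-above : ∀ c t → T (childOK c t) → T (increasing t) → AllLabels (c <_) t
labels-above c nil        _  _ = tt
labels-above c (nd a l r) ca h with increasing-nd {a} {l} {r} h
... | al , ar , il , ir =
  c<a ,
  AllLabels-map (<-trans c<a) l (labels-above a l al il) ,
  AllLabels-map (<-trans c<a) r (labels-above a r ar ir)
  where c<a = <ᵇ⇒< c a ca

root-minimal : ∀ t → T (increasing t) → AllLabels (rootOf t ≤_) t
root-minimal nil        _ = tt
root-minimal (nd a l r) h with increasing-nd {a} {l} {r} h
... | al , ar , il , ir =
  ≤-refl , AllLabels-map <⇒≤ l (labels-above a l al il) , AllLabels-map <⇒≤ r (labels-above a r ar ir)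

childOK-weaken : ∀ {a b} t → a ≤ b → T (childOK b t) → T (childOK a t)
childOK-weaken nil        _   _   = tt
childOK-weaken (nd c _ _) a≤b b<c = <⇒<ᵇ (≤-<-trans a≤b (<ᵇ⇒< _ c b<c))

root≡2 : ∀ t → T (childOK 1 t) → T (increasing t) → 1 ≤ mult 2 t → rootOf t ≡ 2
root≡2 (nd b l r) 1<b h occ =
  ≤-antisym (AllLabels⇒ 2 (nd b l r) (root-minimal (nd b l r) h) occ) (<ᵇ⇒< 1 b 1<b)

two-is-child : ∀ L R → T (increasing (nd 1 L R)) → 1 ≤ mult 2 (nd 1 L R) → rootOf L ≡ 2 ⊎ rootOf R ≡ 2
two-is-child L R h occ with increasing-nd {1} {L} {R} h | mult 2 L in e
... | 1L , 1R , iL , iR | zero  = inj₂ (root≡2 R 1R iR occ)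
... | 1L , 1R , iL , iR | suc _ = inj₁ (root≡2 L 1L iL (subst (1 ≤_) (sym e) (s≤s z≤n)))

-- Shifting all labels by one

shift : Tree → Tree
shift nil        = nil
shift (nd a l r) = nd (suc a) (shift l) (shift r)

unshift : Tree → Tree
unshift nil        = nil
unshift (nd a l r) = nd (pred a) (unshift l) (unshift r)

unshift-shift : ∀ t → unshift (shift t) ≡ t
unshift-shift nil        = refl
unshift-shift (nd a l r) = cong₂ (nd a) (unshift-shift l) (unshift-shift r)

shift-unshift : ∀ t → AllLabels (1 ≤_) t → shift (unshift t) ≡ t
shift-unshift nil              _              = refl
shift-unshift (nd (suc a) l r) (_ , pl , pr) = cong₂ (nd (suc a)) (shift-unshift l pl) (shift-unshift r pr)

size-shift : ∀ t → size (shift t) ≡ size t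
size-shift nil        = refl
size-shift (nd a l r) = cong₂ (λ x y → suc (x + y)) (size-shift l) (size-shift r)

mult-shift : ∀ x t → mult (suc x) (shift t) ≡ mult x t
mult-shift x nil        = refl
mult-shift x (nd a l r) = cong₂ (λ y z → δ x a + y + z) (mult-shift x l) (mult-shift x r)

nonEmpty-shift : ∀ t → nonEmpty (shift t) ≡ nonEmpty t
nonEmpty-shift nil        = refl
nonEmpty-shift (nd _ _ _) = refl

full-shift : ∀ t → full (shift t) ≡ full t
full-shift nil                               = refl
full-shift (nd a nil nil)                    = refl
full-shift (nd a nil (nd _ _ _))             = refl
full-shift (nd a (nd _ _ _) nil)             = refl
full-shift (nd a (nd b l₁ r₁) (nd d l₂ r₂)) =
  cong₂ _∧_ (full-shift (nd b l₁ r₁)) (full-shift (nd d l₂ r₂))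

childOK-shift : ∀ a t → childOK (suc a) (shift t) ≡ childOK a t
childOK-shift a nil        = refl
childOK-shift a (nd _ _ _) = refl

increasing-shift : ∀ t → increasing (shift t) ≡ increasing t
increasing-shift nil        = refl
increasing-shift (nd a l r) =
  cong₂ _∧_ (childOK-shift a l)
    (cong₂ _∧_ (childOK-shift a r) (cong₂ _∧_ (increasing-shift l) (increasing-shift r)))

below-left : ∀ a m → T (nonEmpty m) → T (childOK a m) → suc a < rootOf (shift m)
below-left a (nd d _ _) _ a<d = s≤s (<ᵇ⇒< a d a<d)

childOK-of-below : ∀ a m → suc a < rootOf (shift m) → T (childOK a m)
childOK-of-below a (nd d _ _) (s≤s a<d) = <⇒<ᵇ a<d

record EvenCIT (N : ℕ) (t : Tree) : Set where
  field
    sized      : size t ≡ N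
    covers     : Covers N t
    ordered    : T (increasing t)
    rooted     : T (rootIs 1 t)
    nearlyFull : T (fullExceptRightmost t)

  distinct : ∀ x → mult x t ≤ 1
  distinct = proj₁ (labels-distinct-in-range N t sized covers)

  labelsInRange : AllLabels (λ x → 1 ≤ x × x ≤ N) t
  labelsInRange = proj₂ (labels-distinct-in-range N t sized covers)

module _ {N : ℕ} {t : Tree} (even : isEven N ≡ true) where

  unpack : T (isCIT N t) → EvenCIT N t
  unpack h with ∧-split {isIncreasingTree N t} h
  ... | tree , compl with ∧-split {size t ≡ᵇ N} tree
  ... | sz , rest with ∧-split {labelledBy N t} rest
  ... | lab , rest′ with ∧-split {increasing t} rest′
  ... | inc , root = record
    { sized      = proj₁ (labelledBy⇒ N t lab)
    ; covers     = proj₂ (labelledBy⇒ N t lab)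
    ; ordered    = inc
    ; rooted     = root
    ; nearlyFull = subst (λ b → T (if b then fullExceptRightmost t else full t)) even compl
    }

  pack : EvenCIT N t → T (isCIT N t)
  pack c = ∧-intro
    (∧-intro (≡⇒≡ᵇ _ _ sized)
      (∧-intro (⇒labelledBy N t sized covers) (∧-intro {increasing t} ordered rooted)))
    (subst (λ b → T (if b then fullExceptRightmost t else full t)) (sym even) nearlyFull)
    where open EvenCIT c

roots-distinct : ∀ a b l₁ r₁ d l₂ r₂ → (∀ x → mult x (nd a (nd b l₁ r₁) (nd d l₂ r₂)) ≤ 1) → b ≢ d
roots-distinct a b l₁ r₁ d l₂ r₂ distinct refl = <-irrefl refl
  (≤-trans (+-mono-≤ (mult-root b l₁ r₁) (mult-root b l₂ r₂))
           (≤-trans (mult-children b a (nd b l₁ r₁) (nd b l₂ r₂)) (distinct b)))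

eoc-branch : ∀ {n} a b l₁ r₁ d l₂ r₂ → eoc (nd a (nd b l₁ r₁) (nd d l₂ r₂)) ≡ n →
  (b < d × eoc (nd b l₁ r₁) ≡ n) ⊎ (d ≤ b × eoc (nd d l₂ r₂) ≡ n)
eoc-branch a b l₁ r₁ d l₂ r₂ e with b <ᵇ d in b<d
... | true  = inj₁ (<ᵇ⇒< b d (subst T (sym b<d) tt) , e)
... | false = inj₂ (<ᵇ-false⇒≥ b<d , e)

absent-left : ∀ x a l r → mult x (nd a l r) ≡ 0 → mult x l ≡ 0
absent-left x a l r e = m+n≡0⇒n≡0 (δ x a) (m+n≡0⇒m≡0 (δ x a + mult x l) e)

absent-right : ∀ x a l r → mult x (nd a l r) ≡ 0 → mult x r ≡ 0
absent-right x a l r e = m+n≡0⇒n≡0 (δ x a + mult x l) e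

absent⇒¬rootIs : ∀ x t → mult x t ≡ 0 → rootIs x t ≡ false
absent⇒¬rootIs x nil        _ = refl
absent⇒¬rootIs x (nd a l r) e with a ≡ᵇ x
... | false = refl

absent⇒¬parentOf : ∀ x t → mult x t ≡ 0 → parentOf x t ≡ nothing
absent⇒¬parentOf x nil        _ = refl
absent⇒¬parentOf x (nd a l r) e
  rewrite absent⇒¬rootIs x l (absent-left x a l r e) | absent⇒¬rootIs x r (absent-right x a l r e)
        | absent⇒¬parentOf x l (absent-left x a l r e)
        | absent⇒¬parentOf x r (absent-right x a l r e) = refl

x+y≤1⇒x≡0 : ∀ x y → x + y ≤ 1 → 1 ≤ y → x ≡ 0
x+y≤1⇒x≡0 zero    y _       _   = refl
x+y≤1⇒x≡0 (suc x) y (s≤s h) 1≤y with ≤-trans 1≤y (≤-trans (m≤n+m y x) h)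
... | ()

-- The bijection 𝔗_{M+2} ⊇ {eoc = M+2, pom = k} ≅ {ent = k-1} ⊆ 𝔗_M

module Spine (M : ℕ) (even : isEven M ≡ true) where

  N : ℕ
  N = suc (suc M)

  leaf : Tree
  leaf = nd N nil nil

  -- grow c U pushes the labels a₁, a₂, …, a_r of the right spine of U one step down the spine
  -- (the spine becomes c, a₁+1, …, a_r+1), shifts the left subtrees without moving them, and hangs
  -- the leaf N to the left of the new last spine node; prune is its inverse.
  grow : ℕ → Tree → Tree
  grow c nil        = nd c leaf nil
  grow c (nd a m R) = nd c (shift m) (grow (suc a) R)

  pruneSpine : Tree → Tree → Tree
  pruneSpine L nil          = nil
  pruneSpine L (nd s L′ R′) = nd (pred s) (unshift L) (pruneSpine L′ R′)

  prune : Tree → Tree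
  prune nil        = nil
  prune (nd _ L R) = pruneSpine L R

  prune-grow : ∀ c U → prune (grow c U) ≡ U
  prune-grow c nil        = refl
  prune-grow c (nd a m R) = pruneSpine-grow a m R
    where
    pruneSpine-grow : ∀ a m R → pruneSpine (shift m) (grow (suc a) R) ≡ nd a m R
    pruneSpine-grow a m nil          rewrite unshift-shift m = refl
    pruneSpine-grow a m (nd b m′ R′) rewrite unshift-shift m | pruneSpine-grow b m′ R′ = refl

  -- The minimal chain of nd c L R runs down the right spine and ends at the leaf N.
  SpineChain : Tree → Set
  SpineChain nil                   = ⊥
  SpineChain (nd _ L nil)          = L ≡ leaf
  SpineChain (nd _ L (nd s L′ R′)) = s < rootOf L × SpineChain (nd s L′ R′)

  grow-pruneSpine : ∀ c L R → SpineChain (nd c L R) → AllLabels (1 ≤_) L → AllLabels (1 ≤_) R →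
                    grow c (pruneSpine L R) ≡ nd c L R
  grow-pruneSpine c L nil                refl     _  _                 = refl
  grow-pruneSpine c L (nd zero    L′ R′) _        _  (() , _)
  grow-pruneSpine c L (nd (suc s) L′ R′) (_ , ch) pL (_ , pL′ , pR′)
    rewrite shift-unshift L pL | grow-pruneSpine (suc s) L′ R′ ch pL′ pR′ = refl

  rootOf-grow : ∀ c R → rootOf (grow c R) ≡ c
  rootOf-grow c nil        = refl
  rootOf-grow c (nd _ _ _) = refl

  childOK-grow : ∀ a c R → childOK a (grow c R) ≡ (a <ᵇ c)
  childOK-grow a c nil        = refl
  childOK-grow a c (nd _ _ _) = refl

  size-grow : ∀ c U → size (grow c U) ≡ suc (suc (size U))
  size-grow c nil = refl
  size-grow c (nd a m R) rewrite size-shift m | size-grow (suc a) R =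
    cong suc (trans (+-suc (size m) (suc (size R))) (cong suc (+-suc (size m) (size R))))

  mult-grow : ∀ x c U → mult (suc x) (grow c U) ≡ δ (suc x) c + δ (suc x) N + mult x U
  mult-grow x c nil =
    solve 2 (λ a b → a :+ (b :+ con 0 :+ con 0) :+ con 0 := a :+ b :+ con 0) refl (δ (suc x) c) (δ (suc x) N)
  mult-grow x c (nd a m R) rewrite mult-shift x m | mult-grow x (suc a) R =
    solve 5 (λ dc m′ da dN R′ → dc :+ m′ :+ (da :+ dN :+ R′) := dc :+ dN :+ (da :+ m′ :+ R′)) refl
      (δ (suc x) c) (mult x m) (δ x a) (δ (suc x) N) (mult x R)

  ent-grow : ∀ c a m R → ent (grow c (nd a m R)) ≡ suc (ent (nd a m R))
  ent-grow c a m nil          = refl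
  ent-grow c a m (nd b m′ R′) = ent-grow (suc a) b m′ R′

  nearlyFull-grow : ∀ c a m R → fullExceptRightmost (grow c (nd a m R)) ≡ fullExceptRightmost (nd a m R)
  nearlyFull-grow c a m nil
    rewrite nonEmpty-shift m | full-shift m | ∧-identityʳ (full m) = refl
  nearlyFull-grow c a m (nd b m′ R′)
    rewrite nonEmpty-shift m | full-shift m | nearlyFull-grow (suc a) b m′ R′ = refl

  eoc-spine : ∀ t → SpineChain t → eoc t ≡ N
  eoc-spine (nd c L nil)                        refl          = refl
  eoc-spine (nd c nil (nd s L′ R′))             (() , _)
  eoc-spine (nd c (nd b l r) (nd s L′ R′))      (s<b , chain) =
    trans (cong (if_then eoc (nd b l r) else eoc (nd s L′ R′)) (<ᵇ-false s<b)) (eoc-spine (nd s L′ R′) chain)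

  leaf-on-spine : ∀ c L R → SpineChain (nd c L R) → 1 ≤ mult N L + mult N R
  leaf-on-spine c L nil refl rewrite δ-self N = s≤s z≤n
  leaf-on-spine c L (nd s L′ R′) (_ , chain) =
    ≤-trans (leaf-on-spine s L′ R′ chain) (≤-trans (mult-children N s L′ R′) (m≤n+m _ (mult N L)))

  N-off-spine : ∀ c L s L′ R′ → SpineChain (nd s L′ R′) → mult N (nd c L (nd s L′ R′)) ≤ 1 →
                mult N L ≡ 0 × (s ≡ᵇ N) ≡ false
  N-off-spine c L s L′ R′ chain once =
    x+y≤1⇒x≡0 (mult N L) (mult N (nd s L′ R′)) (≤-trans (mult-children N c L (nd s L′ R′)) once)
      (≤-trans below (mult-children N s L′ R′)) ,
    δ≡0⇒≢ᵇ {N} {s} (x+y≤1⇒x≡0 (δ N s) (mult N L′ + mult N R′)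
      (≤-trans (≤-reflexive (sym (+-assoc (δ N s) (mult N L′) (mult N R′))))
               (≤-trans (mult-right N c L (nd s L′ R′)) once)) below)
    where
    below : 1 ≤ mult N L′ + mult N R′
    below = leaf-on-spine s L′ R′ chain

  parent-spine : ∀ t → SpineChain t → mult N t ≤ 1 → parentOf N t ≡ just (ent t)
  parent-spine (nd c L nil) refl _ rewrite ≡ᵇ-refl N = refl
  parent-spine (nd c L (nd s L′ R′)) (_ , chain) once
    with parent-spine (nd s L′ R′) chain (≤-trans (mult-right N c L (nd s L′ R′)) once)
       | N-off-spine c L s L′ R′ chain once
  ... | parent | N∉L , s≢N rewrite absent⇒¬rootIs N L N∉L | absent⇒¬parentOf N L N∉L | s≢N = parent

  leaf-of-eoc : ∀ L → T (full L) → AllLabels (_≤ N) L → (∀ x → mult x L ≤ 1) → eoc L ≡ N → L ≡ leaf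
  leaf-of-eoc (nd a nil nil)        _  _ _ e = cong (λ x → nd x nil nil) e
  leaf-of-eoc (nd a nil (nd _ _ _)) () _ _ _
  leaf-of-eoc (nd a (nd _ _ _) nil) () _ _ _
  leaf-of-eoc (nd a (nd b l₁ r₁) (nd d l₂ r₂)) f (_ , ≤N₁ , ≤N₂) distinct e =
    ⊥-elim (branches (eoc-branch a b l₁ r₁ d l₂ r₂ e)
      (leaf-of-eoc (nd b l₁ r₁) (proj₁ (∧-split f)) ≤N₁
         (λ x → ≤-trans (mult-left x a (nd b l₁ r₁) (nd d l₂ r₂)) (distinct x)))
      (leaf-of-eoc (nd d l₂ r₂) (proj₂ (∧-split {full (nd b l₁ r₁)} f)) ≤N₂
         (λ x → ≤-trans (mult-right x a (nd b l₁ r₁) (nd d l₂ r₂)) (distinct x))))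
    where
    branches : (b < d × eoc (nd b l₁ r₁) ≡ N) ⊎ (d ≤ b × eoc (nd d l₂ r₂) ≡ N) →
               (eoc (nd b l₁ r₁) ≡ N → nd b l₁ r₁ ≡ leaf) → (eoc (nd d l₂ r₂) ≡ N → nd d l₂ r₂ ≡ leaf) → ⊥
    branches (inj₁ (b<d , eq)) leftLeaf _ with leftLeaf eq
    ... | refl = <⇒≱ b<d (proj₁ ≤N₂)
    branches (inj₂ (d≤b , eq)) _ rightLeaf with rightLeaf eq
    ... | refl = roots-distinct a b l₁ r₁ N l₂ r₂ distinct (≤-antisym (proj₁ ≤N₁) d≤b)

  spine-of-eoc : ∀ t → T (fullExceptRightmost t) → AllLabels (_≤ N) t → (∀ x → mult x t ≤ 1) →
                 eoc t ≡ N → SpineChain t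
  spine-of-eoc (nd c (nd b l r) nil) f (_ , ≤N , _) distinct e =
    leaf-of-eoc (nd b l r) f ≤N (λ x → ≤-trans (mult-left x c (nd b l r) nil) (distinct x)) e
  spine-of-eoc (nd c (nd b l r) (nd s L′ R′)) f (_ , ≤N , ≤N′) distinct e =
    branches (eoc-branch c b l r s L′ R′ e)
      (leaf-of-eoc (nd b l r) (proj₁ (∧-split f)) ≤N
         (λ x → ≤-trans (mult-left x c (nd b l r) (nd s L′ R′)) (distinct x)))
      (spine-of-eoc (nd s L′ R′) (proj₂ (∧-split {full (nd b l r)} f)) ≤N′
         (λ x → ≤-trans (mult-right x c (nd b l r) (nd s L′ R′)) (distinct x)))
    where
    branches : (b < s × eoc (nd b l r) ≡ N) ⊎ (s ≤ b × eoc (nd s L′ R′) ≡ N) →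
               (eoc (nd b l r) ≡ N → nd b l r ≡ leaf) → (eoc (nd s L′ R′) ≡ N → SpineChain (nd s L′ R′)) →
               SpineChain (nd c (nd b l r) (nd s L′ R′))
    branches (inj₁ (b<s , eq)) leftLeaf _ with leftLeaf eq
    ... | refl = ⊥-elim (<⇒≱ b<s (proj₁ ≤N′))
    branches (inj₂ (s≤b , eq)) _ rightChain =
      ≤∧≢⇒< s≤b (≢-sym (roots-distinct c b l r s L′ R′ distinct)) , rightChain eq

  spine-grow-head : ∀ x a m R → SpineChain (grow x (nd a m R)) →
                    suc a < rootOf (shift m) × SpineChain (grow (suc a) R)
  spine-grow-head x a m nil        chain = chain
  spine-grow-head x a m (nd _ _ _) chain = chain

  spine-grow : ∀ x U → T (increasing U) → T (fullExceptRightmost U) → SpineChain (grow x U)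
  spine-grow x (nd a m nil) h f =
    below-left a m (proj₁ (∧-split {nonEmpty m} f)) (proj₁ (increasing-nd {a} {m} {nil} h)) , refl
  spine-grow x (nd a m R@(nd _ _ _)) h f =
    below-left a m (proj₁ (∧-split {nonEmpty m} f)) (proj₁ (increasing-nd {a} {m} {R} h)) ,
    spine-grow (suc a) R (proj₂ (proj₂ (proj₂ (increasing-nd {a} {m} {R} h))))
      (proj₂ (∧-split {full m} (proj₂ (∧-split {nonEmpty m} f))))

  increasing-grow : ∀ a U → T (increasing U) → AllLabels (_≤ M) U → a ≤ M → T (childOK a U) →
                    T (increasing (grow (suc a) U))
  increasing-grow a nil        _ _                 a≤M _   = ∧-intro (<⇒<ᵇ (s≤s a≤M)) tt
  increasing-grow a (nd b m R) h (b≤M , _ , R≤M) a≤M a<b with increasing-nd {b} {m} {R} h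
  ... | bm , bR , im , iR =
    ∧-intro (subst T (sym (childOK-shift a m)) (childOK-weaken m (<⇒≤ (<ᵇ⇒< a b a<b)) bm))
      (∧-intro (subst T (sym (childOK-grow (suc a) (suc b) R)) a<b)
        (∧-intro (subst T (sym (increasing-shift m)) im) (increasing-grow b R iR R≤M b≤M bR)))

  childOK-ungrow : ∀ a R → T (increasing (grow (suc a) R)) → T (childOK a R)
  childOK-ungrow a nil          _ = tt
  childOK-ungrow a (nd b m′ R′) h =
    subst T (childOK-grow (suc a) (suc b) R′)
      (proj₁ (proj₂ (increasing-nd {suc a} {shift m′} {grow (suc b) R′} h)))

  increasing-ungrow : ∀ x U → T (increasing (grow x U)) → SpineChain (grow x U) → T (increasing U)
  increasing-ungrow x nil        _ _     = tt
  increasing-ungrow x (nd a m R) h chain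
    with increasing-nd {x} {shift m} {grow (suc a) R} h | spine-grow-head x a m R chain
  ... | _ , _ , im , iR | a<m , chain′ =
    ∧-intro (childOK-of-below a m a<m)
      (∧-intro (childOK-ungrow a R iR)
        (∧-intro (subst T (increasing-shift m) im) (increasing-ungrow (suc a) R iR chain′)))

  covers-grow : ∀ U → Covers M U → Covers N (grow 1 U)
  covers-grow U cov zero    _ = subst (1 ≤_) (sym (mult-grow 0 1 U)) (s≤s z≤n)
  covers-grow U cov (suc j) (s≤s j<N) with j <? M
  ... | yes j<M = subst (1 ≤_) (sym (mult-grow (suc j) 1 U))
                    (≤-trans (cov j j<M) (m≤n+m (mult (suc j) U) (δ (suc (suc j)) 1 + δ (suc (suc j)) N)))
  ... | no  j≮M with ≤-antisym (≤-pred j<N) (≮⇒≥ j≮M)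
  ...   | refl rewrite mult-grow (suc j) 1 U | δ-self N = s≤s z≤n

  leaf-unique-grow : ∀ U → AllLabels (_≤ M) U → mult N (grow 1 U) ≡ 1
  leaf-unique-grow U ≤M
    rewrite mult-grow (suc M) 1 U | δ-self N | mult-absent (suc M) U (AllLabels-map s≤s U ≤M) = refl

  pruned-in-target : ∀ k U → 2 ≤ k → EvenCIT N (grow 1 U) → SpineChain (grow 1 U) →
                     parentOf N (grow 1 U) ≡ just k → EvenCIT M U × suc (ent U) ≡ k
  pruned-in-target k nil 2≤k c chain p = ⊥-elim (<⇒≱ 2≤k (≤-reflexive k≡1))
    where
    k≡1 : k ≡ 1
    k≡1 = Maybe.just-injective (trans (sym p) (parent-spine (grow 1 nil) chain (EvenCIT.distinct c N)))
  pruned-in-target k (nd a m R) 2≤k c chain p = record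
    { sized      = suc-injective (suc-injective (trans (sym (size-grow 1 U)) sized))
    ; covers     = covers′
    ; ordered    = increasing-ungrow 1 U ordered chain
    ; rooted     = subst (λ x → T (x ≡ᵇ 1)) (sym a≡1) tt
    ; nearlyFull = subst T (nearlyFull-grow 1 a m R) nearlyFull
    } , Maybe.just-injective (trans (sym parent) p)
    where
    open EvenCIT c
    U = nd a m R

    parent : parentOf N (grow 1 U) ≡ just (suc (ent U))
    parent = trans (parent-spine (grow 1 U) chain (distinct N)) (cong just (ent-grow 1 a m R))

    covers′ : Covers M U
    covers′ i i<M =
      subst (1 ≤_) (trans (mult-grow (suc i) 1 U) (cong (λ z → z + mult (suc i) U) (δ-≢ N≢)))
        (covers (suc i) (s≤s (m≤n⇒m≤1+n i<M)))
      where
      N≢ : N ≢ suc (suc i)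
      N≢ N≡ = <-irrefl (sym (suc-injective (suc-injective N≡))) i<M

    -- 2 hangs below the root 1, and the left child of the root is above the right one
    a≡1 : a ≡ 1
    a≡1 with two-is-child (shift m) (grow (suc a) R) ordered (covers 1 (s≤s (s≤s z≤n)))
    ... | inj₂ root≡2 = suc-injective (trans (sym (rootOf-grow (suc a) R)) root≡2)
    ... | inj₁ root≡2 = ⊥-elim (<⇒≱ 1<suc-a
                          (≤-pred (subst (suc (suc a) ≤_) root≡2 (proj₁ (spine-grow-head 1 a m R chain)))))
      where
      1<suc-a : 1 < suc a
      1<suc-a = <ᵇ⇒< 1 (suc a) (subst T (childOK-grow 1 (suc a) R)
                  (proj₁ (proj₂ (increasing-nd {1} {shift m} {grow (suc a) R} ordered))))

  grown-in-source : ∀ U → EvenCIT M U →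
    EvenCIT N (grow 1 U) × eoc (grow 1 U) ≡ N × parentOf N (grow 1 U) ≡ just (suc (ent U))
  grown-in-source nil        c = ⊥-elim (EvenCIT.nearlyFull c)
  grown-in-source (nd a m R) c = record
    { sized      = trans (size-grow 1 U) (cong (λ x → suc (suc x)) sized)
    ; covers     = covers-grow U covers
    ; ordered    = increasing-grow 0 U ordered ≤M z≤n (<⇒<ᵇ (proj₁ (proj₁ labelsInRange)))
    ; rooted     = tt
    ; nearlyFull = subst T (sym (nearlyFull-grow 1 a m R)) nearlyFull
    } , eoc-spine (grow 1 U) chain ,
        trans (parent-spine (grow 1 U) chain (≤-reflexive (leaf-unique-grow U ≤M)))
              (cong just (ent-grow 1 a m R))
    where
    open EvenCIT c
    U = nd a m R
    ≤M : AllLabels (_≤ M) U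
    ≤M = AllLabels-map proj₂ U labelsInRange
    chain : SpineChain (grow 1 U)
    chain = spine-grow 1 U ordered nearlyFull

  source-is-grown : ∀ t → EvenCIT N t → eoc t ≡ N → SpineChain t × grow 1 (prune t) ≡ t
  source-is-grown (nd a L R) c e =
    chain , subst (λ x → grow x (pruneSpine L R) ≡ nd a L R) (≡ᵇ⇒≡ a 1 rooted)
              (grow-pruneSpine a L R chain (positive L (proj₁ (proj₂ labelsInRange)))
                                      (positive R (proj₂ (proj₂ labelsInRange))))
    where
    open EvenCIT c
    chain : SpineChain (nd a L R)
    chain = spine-of-eoc (nd a L R) nearlyFull (AllLabels-map proj₂ (nd a L R) labelsInRange) distinct e
    positive : ∀ t → AllLabels (λ x → 1 ≤ x × x ≤ N) t → AllLabels (1 ≤_) t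
    positive = AllLabels-map proj₁

  Source : ℕ → Set
  Source k = Σ Tree λ t → T (isCIT N t) × eoc t ≡ N × parentOf N t ≡ just k

  Source-≡ : ∀ {k} {x y : Source k} → proj₁ x ≡ proj₁ y → x ≡ y
  Source-≡ {x = t , p , e , q} {.t , p′ , e′ , q′} refl =
    cong₂ (λ p (e , q) → t , p , e , q) (T-irrelevant p p′)
      (cong₂ _,_ (≡-irrelevant e e′) (Decidable⇒UIP.≡-irrelevant (Maybe.≡-dec _≟_) q q′))

  EntSet-≡ : ∀ {j} {x y : EntSet M j} → proj₁ x ≡ proj₁ y → x ≡ y
  EntSet-≡ {x = U , p , e} {.U , p′ , e′} refl =
    cong₂ (λ p e → U , p , e) (T-irrelevant p p′) (≡-irrelevant e e′)

  bijection : ∀ k → 2 ≤ k → Source k ↔ EntSet M (k ∸ 1)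
  bijection k 2≤k =
    mk↔ₛ′ to from (λ _ → EntSet-≡ (prune-grow 1 _)) (λ (t , p , e , _) → Source-≡ (regrow t p e))
    where
    regrow : ∀ t → T (isCIT N t) → eoc t ≡ N → grow 1 (prune t) ≡ t
    regrow t p e = proj₂ (source-is-grown t (unpack even p) e)

    to : Source k → EntSet M (k ∸ 1)
    to (t , p , e , q) with source-is-grown t (unpack even p) e
    ... | chain , t≡ with pruned-in-target k (prune t) 2≤k (subst (EvenCIT N) (sym t≡) (unpack even p))
                            (subst SpineChain (sym t≡) chain) (subst (λ s → parentOf N s ≡ just k) (sym t≡) q)
    ... | c , ent≡ = prune t , pack even c , cong pred ent≡

    from : EntSet M (k ∸ 1) → Source k
    from (U , p , e) with grown-in-source U (unpack even p)
    ... | c , eoc≡ , parent≡ =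
      grow 1 U , pack even c , eoc≡ , trans parent≡ (cong just (trans (cong suc e) (m+[n∸m]≡n (<⇒≤ 2≤k))))

isEven-double : ∀ n → isEven (n + n) ≡ true
isEven-double zero    = refl
isEven-double (suc n) rewrite +-suc n n = isEven-double n

proposition6p1 : (n k : ℕ) → 2 ≤ n → 2 ≤ k → k ≤ (n + n) ∸ 2 →
    F n (n + n) k ↔ EntSet ((n + n) ∸ 2) (k ∸ 1)
proposition6p1 (suc n) k _ 2≤k _ rewrite +-suc n n = Spine.bijection (n + n) (isEven-double n) k 2≤k
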